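{- There exist a periodic graph $\mathcal{G}$ with footprint $G$ and a retract $H$ of $G$ such that $c(\mathcal{G}[H])>c(\mathcal{G})$.
   Context: All graphs are finite, undirected and reflexive. A retraction of a graph $G$ onto a subgraph $H$ is a graph homomorphism $h:G\to H$ (edges map to edges, where loops are allowed as images) that is the identity on $H$; $H$ is then a retract of $G$. A periodic graph with period $p\ge1$ is a sequence $\mathcal{G}=(G_0,\dots,G_{p-1})$ of graphs $G_i=(V,E_i)$ on a common vertex set, extended by $G_{i+p}=G_i$; its footprint is $G=(V,\bigcup_iE_i)$, assumed connected. For $H\subseteq G$, $\mathcal{G}[H]=(G_0[V(H)],\dots,G_{p-1}[V(H)])$ (induced subgraphs). Cops and Robber on a periodic graph with $k$ cops (perfect information): cops choose starting vertices, then the robber; in each round $t=0,1,\dots$ each cop moves to a vertex of $N_{G_{t\bmod p}}[\text{its position}]$, then the robber likewise; the cops win if a cop ever moves onto the robber's vertex. The cop number $c(\cdot)$ is the least $k$ such that $k$ cops have a winning strategy. -}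

module Defs where

open import Data.Nat using (ℕ; zero; suc; _<_)
open import Data.Nat.DivMod using (_mod_)
open import Data.Fin using (Fin)
open import Data.Bool using (Bool; T)
open import Data.Product using (Σ; ∃; _×_; _,_)
open import Data.Sum using (_⊎_)
open import Relation.Nullary using (¬_)
open import Relation.Binary.PropositionalEquality using (_≡_)
open import Relation.Binary.Construct.Closure.ReflexiveTransitive using (Star)

record Graph (n : ℕ) : Set where
  field
    adj     : Fin n → Fin n → Bool
    adj-refl : ∀ v → T (adj v v)
    adj-sym  : ∀ u v → T (adj u v) → T (adj v u)

Edge : ∀ {n} → Graph n → Fin n → Fin n → Set
Edge G u v = T (Graph.adj G u v)

-- A periodic graph with period p = suc q ≥ 1: graphs G_0 … G_{p-1}
-- on the common vertex set Fin n, extended by G_{t+p} = G_t.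
record PeriodicGraph (n : ℕ) : Set where
  field
    q     : ℕ
    layer : Fin (suc q) → Graph n

period : ∀ {n} → PeriodicGraph n → ℕ
period 𝒢 = suc (PeriodicGraph.q 𝒢)

At : ∀ {n} → PeriodicGraph n → ℕ → Graph n
At 𝒢 t = PeriodicGraph.layer 𝒢 (t mod period 𝒢)

FEdge : ∀ {n} → PeriodicGraph n → Fin n → Fin n → Set
FEdge 𝒢 u v = ∃ λ i → Edge (PeriodicGraph.layer 𝒢 i) u v

FootprintConnected : ∀ {n} → PeriodicGraph n → Set
FootprintConnected 𝒢 = ∀ u v → Star (FEdge 𝒢) u v

record Subgraph {n : ℕ} (𝒢 : PeriodicGraph n) : Set where
  field
    m       : ℕ
    emb     : Fin m → Fin n
    emb-inj : ∀ a b → emb a ≡ emb b → a ≡ b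
    graph   : Graph m
    edges⊆  : ∀ a b → Edge graph a b → FEdge 𝒢 (emb a) (emb b)

IsRetract : ∀ {n} (𝒢 : PeriodicGraph n) → Subgraph 𝒢 → Set
IsRetract {n} 𝒢 H =
  Σ (Fin n → Fin (Subgraph.m H)) λ h →
    (∀ a → h (Subgraph.emb H a) ≡ a) ×
    (∀ u v → FEdge 𝒢 u v → Edge (Subgraph.graph H) (h u) (h v))

induce : ∀ {n m} → PeriodicGraph n → (Fin m → Fin n) → PeriodicGraph m
induce 𝒢 e = record
  { q = PeriodicGraph.q 𝒢
  ; layer = λ i → let G = PeriodicGraph.layer 𝒢 i in record
      { adj = λ a b → Graph.adj G (e a) (e b)
      ; adj-refl = λ a → Graph.adj-refl G (e a)
      ; adj-sym = λ a b → Graph.adj-sym G (e a) (e b) } }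

restrict : ∀ {n} (𝒢 : PeriodicGraph n) (H : Subgraph 𝒢) → PeriodicGraph (Subgraph.m H)
restrict 𝒢 H = induce 𝒢 (Subgraph.emb H)

-- CopsWinFrom 𝒢 k t cs r : at the start of
-- round t, with cops at positions cs and robber at r, the cops can force
-- a capture (inductive = capture in finitely many rounds).
data CopsWinFrom {n : ℕ} (𝒢 : PeriodicGraph n) (k : ℕ)
       : ℕ → (Fin k → Fin n) → Fin n → Set where
  round : ∀ {t cs r} (cs′ : Fin k → Fin n) →
          (∀ i → Edge (At 𝒢 t) (cs i) (cs′ i)) →
          ((∃ λ i → cs′ i ≡ r) ⊎
           (∀ r′ → Edge (At 𝒢 t) r r′ → CopsWinFrom 𝒢 k (suc t) cs′ r′)) →
          CopsWinFrom 𝒢 k t cs r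

CopsWin : ∀ {n} → PeriodicGraph n → ℕ → Set
CopsWin {n} 𝒢 k = Σ (Fin k → Fin n) λ cs → ∀ r → CopsWinFrom 𝒢 k 0 cs r

IsCopNumber : ∀ {n} → PeriodicGraph n → ℕ → Set
IsCopNumber 𝒢 c = CopsWin 𝒢 c × (∀ j → j < c → ¬ CopsWin 𝒢 j)

{-# OPTIONS --safe #-}
-- Let the three perfect matchings of K₄ be the layers, used cyclically. Two cops
-- standing on different pairs of the first layer dominate it, but a single cop can
-- never become adjacent to the robber: the robber always owns the pair complementary
-- to the cop's. Adding a hub that is adjacent to everything in every layer lets one
-- cop win, while K₄ is a retract of the new footprint K₅ (send the hub anywhere) and
-- inducing on it gives back the matchings.
module Submission where

open import Defs
open import Data.Nat using (ℕ; zero; suc; _<_; _≡ᵇ_; s≤s; z≤n)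
open import Data.Nat.DivMod using (_mod_)
open import Data.Fin using (Fin; toℕ; #_) renaming (zero to fzero; suc to fsuc)
open import Data.Fin.Properties using (all?; any?; suc-injective)
open import Data.Bool using (Bool; true; false; T; _∨_; if_then_else_)
open import Data.Unit using (tt)
open import Data.Empty using (⊥-elim)
open import Data.Product using (Σ; ∃; _×_; _,_)
open import Data.Sum using (inj₁; inj₂)
open import Relation.Nullary using (¬_; ¬?)
open import Relation.Nullary.Decidable using (toWitness; _→-dec_; _×-dec_; T?)
open import Relation.Binary.PropositionalEquality using (_≡_; refl; sym; subst)
open import Relation.Binary.Construct.Closure.ReflexiveTransitive using (ε; _◅_)

Threatened : ∀ {n k} → PeriodicGraph n → ℕ → (Fin k → Fin n) → Fin n → Set
Threatened 𝒢 t cs r = ∃ λ i → Edge (At 𝒢 t) (cs i) r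

approach : ∀ {n} → Graph n → Fin n → Fin n → Fin n
approach G c r = if Graph.adj G c r then r else c

approach-edge : ∀ {n} (G : Graph n) c r → Edge G c (approach G c r)
approach-edge G c r with Graph.adj G c r in adjacent
... | true  = subst T (sym adjacent) tt
... | false = Graph.adj-refl G c

approach-reaches : ∀ {n} (G : Graph n) {c r} → Edge G c r → approach G c r ≡ r
approach-reaches G {c} {r} e with Graph.adj G c r in adjacent
... | true  = refl
... | false = ⊥-elim e

dominating⇒copsWin : ∀ {n k} (𝒢 : PeriodicGraph n) (cs : Fin k → Fin n) →
                     (∀ r → Threatened 𝒢 0 cs r) → CopsWin 𝒢 k
dominating⇒copsWin 𝒢 cs dominating = cs , λ r →
  let (i , e) = dominating r
  in round (λ j → approach (At 𝒢 0) (cs j) r) (λ j → approach-edge (At 𝒢 0) (cs j) r)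
           (inj₁ (i , approach-reaches (At 𝒢 0) e))

RobberEscapes : ∀ {n} → PeriodicGraph n → ℕ → Set
RobberEscapes {n} 𝒢 k = ∀ t (cs : Fin k → Fin n) r cs′ → ¬ Threatened 𝒢 t cs r →
  (∀ i → Edge (At 𝒢 t) (cs i) (cs′ i)) →
  ∃ λ r′ → Edge (At 𝒢 t) r r′ × ¬ Threatened 𝒢 (suc t) cs′ r′

escapes⇒¬copsWinFrom : ∀ {n k} {𝒢 : PeriodicGraph n} → RobberEscapes 𝒢 k →
                       ∀ {t cs r} → ¬ Threatened 𝒢 t cs r → ¬ CopsWinFrom 𝒢 k t cs r
escapes⇒¬copsWinFrom {𝒢 = 𝒢} escape {t} {cs} safe (round cs′ moves (inj₁ (i , caught))) =
  safe (i , subst (Edge (At 𝒢 t) (cs i)) caught (moves i))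
escapes⇒¬copsWinFrom escape {t} {cs} {r} safe (round cs′ moves (inj₂ next))
  with escape t cs r cs′ safe moves
... | r′ , step , safe′ = escapes⇒¬copsWinFrom escape safe′ (next r′ step)

escapes⇒¬copsWin : ∀ {n k} {𝒢 : PeriodicGraph n} → RobberEscapes 𝒢 k →
                   (∀ cs → ∃ λ r → ¬ Threatened 𝒢 0 cs r) → ¬ CopsWin 𝒢 k
escapes⇒¬copsWin escape start (cs , win) =
  let (r , safe) = start cs in escapes⇒¬copsWinFrom escape safe (win r)

¬copsWin-noCops : ∀ {n} (𝒢 : PeriodicGraph n) → Fin n → ¬ CopsWin 𝒢 0
¬copsWin-noCops 𝒢 v = escapes⇒¬copsWin stay (λ _ → v , λ ())
  where
  stay : RobberEscapes 𝒢 0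
  stay t _ r _ _ _ = r , Graph.adj-refl (At 𝒢 t) r , λ ()

addHub : ∀ {n} → Graph n → Graph (suc n)
addHub {n} G = record { adj = adj ; adj-refl = adj-refl ; adj-sym = adj-sym }
  where
  adj : Fin (suc n) → Fin (suc n) → Bool
  adj fzero    _        = true
  adj (fsuc _) fzero    = true
  adj (fsuc a) (fsuc b) = Graph.adj G a b

  adj-refl : ∀ v → T (adj v v)
  adj-refl fzero    = tt
  adj-refl (fsuc a) = Graph.adj-refl G a

  adj-sym : ∀ u v → T (adj u v) → T (adj v u)
  adj-sym fzero    fzero    _ = tt
  adj-sym fzero    (fsuc _) _ = tt
  adj-sym (fsuc _) fzero    _ = tt
  adj-sym (fsuc a) (fsuc b) e = Graph.adj-sym G a b e

addHub-toHub : ∀ {n} (G : Graph n) u → Edge (addHub G) u fzero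
addHub-toHub G fzero    = tt
addHub-toHub G (fsuc _) = tt

withHub : ∀ {n} → PeriodicGraph n → PeriodicGraph (suc n)
withHub 𝒢 = record { q = PeriodicGraph.q 𝒢 ; layer = λ i → addHub (PeriodicGraph.layer 𝒢 i) }

withHub-connected : ∀ {n} (𝒢 : PeriodicGraph n) → FootprintConnected (withHub 𝒢)
withHub-connected 𝒢 u v =
  (fzero , addHub-toHub (PeriodicGraph.layer 𝒢 fzero) u) ◅ (fzero , tt) ◅ ε

isCopNumber-withHub : ∀ {n} (𝒢 : PeriodicGraph n) → IsCopNumber (withHub 𝒢) 1
isCopNumber-withHub 𝒢 = dominating⇒copsWin (withHub 𝒢) (λ _ → fzero) (λ _ → fzero , tt) , fewer
  where
  fewer : ∀ j → j < 1 → ¬ CopsWin (withHub 𝒢) j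
  fewer zero    _ = ¬copsWin-noCops (withHub 𝒢) fzero
  fewer (suc _) (s≤s ())

FootprintComplete : ∀ {n} → PeriodicGraph n → Set
FootprintComplete 𝒢 = ∀ a b → FEdge 𝒢 a b

completeGraph : ∀ n → Graph n
completeGraph n = record { adj = λ _ _ → true ; adj-refl = λ _ → tt ; adj-sym = λ _ _ _ → tt }

dropHub : ∀ {n} (𝒢 : PeriodicGraph n) → FootprintComplete 𝒢 → Subgraph (withHub 𝒢)
dropHub {n} 𝒢 complete = record
  { m = n ; emb = fsuc ; emb-inj = λ _ _ → suc-injective
  ; graph = completeGraph n ; edges⊆ = λ a b _ → complete a b }

dropHub-retract : ∀ {n} (𝒢 : PeriodicGraph n) (complete : FootprintComplete 𝒢) →
                  Fin n → IsRetract (withHub 𝒢) (dropHub 𝒢 complete)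
dropHub-retract 𝒢 complete a₀ = collapseHub , (λ _ → refl) , λ _ _ _ → tt
  where
  collapseHub : Fin _ → Fin _
  collapseHub fzero    = a₀
  collapseHub (fsuc a) = a

matchedPair : ℕ → ℕ → ℕ → Bool
matchedPair 0 0 1 = true
matchedPair 0 2 3 = true
matchedPair 1 0 2 = true
matchedPair 1 1 3 = true
matchedPair 2 0 3 = true
matchedPair 2 1 2 = true
matchedPair _ _ _ = false

matchingAdj : Fin 3 → Fin 4 → Fin 4 → Bool
matchingAdj i a b =
  (toℕ a ≡ᵇ toℕ b) ∨ matchedPair (toℕ i) (toℕ a) (toℕ b) ∨ matchedPair (toℕ i) (toℕ b) (toℕ a)

matchingLayer : Fin 3 → Graph 4
matchingLayer i = record
  { adj = matchingAdj i
  ; adj-refl = toWitness {a? = all? λ i → all? λ a → T? (matchingAdj i a a)} tt i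
  ; adj-sym = toWitness {a? = all? λ i → all? λ a → all? λ b →
                T? (matchingAdj i a b) →-dec T? (matchingAdj i b a)} tt i }

matchings : PeriodicGraph 4
matchings = record { q = 2 ; layer = matchingLayer }

matchings-complete : FootprintComplete matchings
matchings-complete = toWitness {a? = all? λ a → all? λ b → any? λ i → T? (matchingAdj i a b)} tt

copsWin-matchings : CopsWin matchings 2
copsWin-matchings = dominating⇒copsWin matchings guards
  (toWitness {a? = all? λ r → any? λ i → T? (matchingAdj fzero (guards i) r)} tt)
  where
  guards : Fin 2 → Fin 4
  guards fzero    = # 0
  guards (fsuc _) = # 2

-- A robber outside the cop's pair of layer i owns the complementary pair;
-- the cop's partner in layer j lies in it, and the robber moves to the other vertex.
matching-escape : ∀ i j c r c′ → ¬ T (matchingAdj i c r) → T (matchingAdj i c c′) →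
                  ∃ λ r′ → T (matchingAdj i r r′) × ¬ T (matchingAdj j c′ r′)
matching-escape = toWitness {a? = all? λ i → all? λ j → all? λ c → all? λ r → all? λ c′ →
  ¬? (T? (matchingAdj i c r)) →-dec T? (matchingAdj i c c′) →-dec
  any? λ r′ → T? (matchingAdj i r r′) ×-dec ¬? (T? (matchingAdj j c′ r′))} tt

matching-unthreatened : ∀ c → ∃ λ r → ¬ T (matchingAdj fzero c r)
matching-unthreatened = toWitness {a? = all? λ c → any? λ r → ¬? (T? (matchingAdj fzero c r))} tt

¬copsWin-matchings : ¬ CopsWin matchings 1
¬copsWin-matchings = escapes⇒¬copsWin escape start
  where
  escape : RobberEscapes matchings 1
  escape t cs r cs′ safe moves =
    let (r′ , step , safe′) = matching-escape (t mod 3) (suc t mod 3) (cs fzero) r (cs′ fzero)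
                                (λ e → safe (fzero , e)) (moves fzero)
    in r′ , step , λ { (fzero , e) → safe′ e ; (fsuc () , _) }

  start : ∀ cs → ∃ λ r → ¬ Threatened matchings 0 cs r
  start cs =
    let (r , safe) = matching-unthreatened (cs fzero)
    in r , λ { (fzero , e) → safe e ; (fsuc () , _) }

isCopNumber-matchings : IsCopNumber matchings 2
isCopNumber-matchings = copsWin-matchings , fewer
  where
  fewer : ∀ j → j < 2 → ¬ CopsWin matchings j
  fewer zero          _                = ¬copsWin-noCops matchings fzero
  fewer (suc zero)    _                = ¬copsWin-matchings
  fewer (suc (suc _)) (s≤s (s≤s ()))

proposition3 : Σ ℕ λ n → Σ (PeriodicGraph n) λ 𝒢 →
    FootprintConnected 𝒢 × Σ (Subgraph 𝒢) λ H → IsRetract 𝒢 H ×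
      Σ ℕ λ c₁ → Σ ℕ λ c₂ →
        IsCopNumber 𝒢 c₁ × IsCopNumber (restrict 𝒢 H) c₂ × c₁ < c₂
proposition3 =
  5 , withHub matchings , withHub-connected matchings ,
  dropHub matchings matchings-complete ,
  dropHub-retract matchings matchings-complete fzero ,
  -- restrict (withHub matchings) (dropHub …) is matchings up to record η.
  1 , 2 , isCopNumber-withHub matchings , isCopNumber-matchings , s≤s (s≤s z≤n)
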